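{- For each positive integer $n$, there exist infinitely many sets $A$ of $n$ positive integers that are prime, i.e., whose only divisor is $A$ itself.
   Context: For a finite set $A$ of positive integers, write $\sum A$ for the sum of its elements (with $\sum\emptyset=0$). A subset $B\subseteq A$ is a divisor of $A$ if $\sum B$ divides $\sum A$ (so the empty set is not a divisor of a nonempty $A$). $A$ is called prime if the only divisor of $A$ is $A$ itself. -}

module Defs where

open import Data.Nat using (ℕ; _<_)
open import Data.List using (List; length)
open import Data.Nat.ListAction using (sum)
open import Data.List.Relation.Unary.All using (All)
open import Data.List.Relation.Unary.Linked using (Linked)
open import Data.List.Relation.Binary.Sublist.Propositional using (_⊆_)
open import Data.Nat.Divisibility using (_∣_)
open import Relation.Binary.PropositionalEquality using (_≡_)
open import Data.Product using (_×_)

-- A finite set of positive integers, represented canonically as a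
-- strictly increasing list of positive naturals.
IsPosSet : List ℕ → Set
IsPosSet A = Linked _<_ A × All (0 <_) A

IsPosSetOfSize : ℕ → List ℕ → Set
IsPosSetOfSize n A = IsPosSet A × length A ≡ n

-- For a set A (strictly increasing list), its subsets correspond exactly
-- to its sublists.  B is a divisor of A if B ⊆ A and ΣB ∣ ΣA.
IsDivisor : List ℕ → List ℕ → Set
IsDivisor B A = (B ⊆ A) × (sum B ∣ sum A)

IsPrimeSet : List ℕ → Set
IsPrimeSet A = ∀ B → IsDivisor B A → B ≡ A

-- Take xs = [2, 3, …, n] with sum T, and add one large element N so that
-- the total S = T + N is T! · c + 1.  A subset avoiding N has sum s with
-- 2 ≤ s ≤ T, and s divides T! · c, so s cannot divide S.  A subset
-- containing N has sum at least N > S / 2, and the only divisor of S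
-- above S / 2 is S itself, which forces the subset to be everything.
-- Letting c grow makes S, hence A, larger than any given finite list of sets.
module Submission where

open import Defs
open import Data.Nat using (ℕ; _≥_)
open import Data.List using (List)
open import Data.List.Membership.Propositional using (_∉_)
open import Data.Product using (Σ; _×_)

open import Data.Nat using (zero; suc; _+_; _*_; _∸_; _!; _≤_; _<_; z≤n; s≤s; z<s)
open import Data.Nat.Properties
open import Data.Nat.Divisibility
open import Data.Nat.ListAction using (sum)
open import Data.Nat.ListAction.Properties using (sum-++)
open import Data.List using ([]; _∷_; _++_; [_]; length; map)
open import Data.List.Relation.Unary.All as All using (All; []; _∷_)
open import Data.List.Relation.Unary.All.Properties using (++⁺)
open import Data.List.Relation.Unary.Any using (here; there)
open import Data.List.Membership.Propositional using (_∈_)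
open import Data.List.Relation.Unary.Linked using (Linked; [-]; _∷_)
open import Data.List.Relation.Binary.Sublist.Propositional using (_⊆_; []; _∷_; _∷ʳ_)
open import Data.List.Relation.Binary.Sublist.Propositional.Properties using (All-resp-⊆)
open import Data.Product using (_,_)
open import Data.Sum using (_⊎_; inj₁; inj₂)
open import Data.Empty using (⊥-elim)
open import Relation.Binary.PropositionalEquality using (_≡_; refl; sym; trans; cong; subst)

sum-∷ʳ : ∀ xs x → sum (xs ++ [ x ]) ≡ sum xs + x
sum-∷ʳ xs x = trans (sum-++ xs [ x ]) (cong (sum xs +_) (+-identityʳ x))

sum-⊆ : ∀ {ys xs} → ys ⊆ xs → sum ys ≤ sum xs
sum-⊆ []                    = z≤n
sum-⊆ (x ∷ʳ ys⊆xs)          = ≤-trans (sum-⊆ ys⊆xs) (m≤n+m _ x)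
sum-⊆ {x ∷ _} (refl ∷ ys⊆xs) = +-monoʳ-≤ x (sum-⊆ ys⊆xs)

⊆∧sum≡⇒≡ : ∀ {ys xs} → ys ⊆ xs → All (0 <_) xs → sum ys ≡ sum xs → ys ≡ xs
⊆∧sum≡⇒≡ [] _ _ = refl
⊆∧sum≡⇒≡ (x ∷ʳ ys⊆xs) (x>0 ∷ _) eq =
  ⊥-elim (<⇒≢ (<-≤-trans (s≤s (sum-⊆ ys⊆xs)) (+-monoˡ-≤ _ x>0)) eq)
⊆∧sum≡⇒≡ {x ∷ _} (refl ∷ ys⊆xs) (_ ∷ xs>0) eq =
  cong (x ∷_) (⊆∧sum≡⇒≡ ys⊆xs xs>0 (+-cancelˡ-≡ x _ _ eq))

⊆-∷ʳ⁻ : ∀ {ys} xs x → ys ⊆ xs ++ [ x ] →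
  ys ⊆ xs ⊎ Σ (List ℕ) (λ zs → ys ≡ zs ++ [ x ] × zs ⊆ xs)
⊆-∷ʳ⁻ []       x (.x ∷ʳ []) = inj₁ []
⊆-∷ʳ⁻ []       x (refl ∷ []) = inj₂ ([] , refl , [])
⊆-∷ʳ⁻ (y ∷ xs) x (.y ∷ʳ ys⊆) with ⊆-∷ʳ⁻ xs x ys⊆
... | inj₁ ys⊆xs               = inj₁ (y ∷ʳ ys⊆xs)
... | inj₂ (zs , eq , zs⊆xs)   = inj₂ (zs , eq , y ∷ʳ zs⊆xs)
⊆-∷ʳ⁻ (y ∷ xs) x (refl ∷ ys⊆) with ⊆-∷ʳ⁻ xs x ys⊆
... | inj₁ ys⊆xs               = inj₁ (refl ∷ ys⊆xs)
... | inj₂ (zs , refl , zs⊆xs) = inj₂ (y ∷ zs , refl , refl ∷ zs⊆xs)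

m∣n∧n<m+m⇒m≡n : ∀ {m n} → 0 < n → m ∣ n → n < m + m → m ≡ n
m∣n∧n<m+m⇒m≡n n>0 (divides zero refl) _ = ⊥-elim (<-irrefl refl n>0)
m∣n∧n<m+m⇒m≡n {m} _ (divides 1 refl) _ = sym (+-identityʳ m)
m∣n∧n<m+m⇒m≡n {m} _ (divides (suc (suc q)) refl) n<m+m =
  ⊥-elim (<⇒≱ n<m+m (+-monoʳ-≤ m (m≤m+n m (q * m))))

m≤n⇒m∣n! : ∀ {m n} → 0 < m → m ≤ n → m ∣ n !
m≤n⇒m∣n! {suc m} _ m≤n = ∣-trans (m∣m*n (m !)) (m≤n⇒m!∣n! m≤n)

m≤n⇒m∤n!*c+1 : ∀ {m n} c → 2 ≤ m → m ≤ n → m ∤ n ! * c + 1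
m≤n⇒m∤n!*c+1 c 2≤m m≤n m∣ =
  <⇒≢ 2≤m (sym (∣1⇒≡1 (∣m+n∣m⇒∣n m∣ (∣m⇒∣m*n c (m≤n⇒m∣n! (<-trans z<s 2≤m) m≤n)))))

⊆⇒sum∤ : ∀ {ys xs S} → 0 < S → All (2 ≤_) xs →
  (∀ s → 2 ≤ s → s ≤ sum xs → s ∤ S) → ys ⊆ xs → sum ys ∤ S
⊆⇒sum∤ {[]}    S>0 _    _              _     0∣S = <⇒≢ S>0 (sym (0∣⇒≡0 0∣S))
⊆⇒sum∤ {y ∷ _} _   xs≥2 noSmallDivisor ys⊆xs with All-resp-⊆ ys⊆xs xs≥2
... | y≥2 ∷ _ = noSmallDivisor _ (≤-trans y≥2 (m≤m+n y _)) (sum-⊆ ys⊆xs)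

isPrimeSet-∷ʳ : ∀ xs N → All (2 ≤_) xs → sum xs < N →
  (∀ s → 2 ≤ s → s ≤ sum xs → s ∤ sum xs + N) → IsPrimeSet (xs ++ [ N ])
isPrimeSet-∷ʳ xs N xs≥2 T<N noSmallDivisor ys (ys⊆ , ys∣) =
  divisor≡whole (⊆-∷ʳ⁻ xs N ys⊆) (subst (sum ys ∣_) (sum-∷ʳ xs N) ys∣)
  where
  T = sum xs

  total>0 : 0 < T + N
  total>0 = <-≤-trans (≤-<-trans z≤n T<N) (m≤n+m N T)

  divisor≡whole : ys ⊆ xs ⊎ Σ (List ℕ) (λ zs → ys ≡ zs ++ [ N ] × zs ⊆ xs) →
    sum ys ∣ T + N → ys ≡ xs ++ [ N ]
  divisor≡whole (inj₁ ys⊆xs) ∣total = ⊥-elim (⊆⇒sum∤ total>0 xs≥2 noSmallDivisor ys⊆xs ∣total)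
  divisor≡whole (inj₂ (zs , refl , zs⊆xs)) ∣total =
    cong (_++ [ N ]) (⊆∧sum≡⇒≡ zs⊆xs (All.map (<-trans z<s) xs≥2) sum-zs≡T)
    where
    -- The sum of zs ++ [ N ] is at least N > T, so more than half of T + N.
    more-than-half : T + N < sum zs + N + (sum zs + N)
    more-than-half = <-≤-trans (+-monoˡ-< N T<N) (+-mono-≤ (m≤n+m N (sum zs)) (m≤n+m N (sum zs)))

    sum-zs≡T : sum zs ≡ T
    sum-zs≡T = +-cancelʳ-≡ N _ _ (m∣n∧n<m+m⇒m≡n total>0
      (subst (_∣ T + N) (sum-∷ʳ zs N) ∣total) more-than-half)

interval : ℕ → ℕ → List ℕ
interval a zero    = []
interval a (suc k) = a ∷ interval (suc a) k

All-≤-interval : ∀ a k → All (a ≤_) (interval a k)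
All-≤-interval a zero    = []
All-≤-interval a (suc k) = ≤-refl ∷ All.map (λ a<b → ≤-trans (n≤1+n a) a<b) (All-≤-interval (suc a) k)

length-interval-∷ʳ : ∀ a k N → length (interval a k ++ [ N ]) ≡ suc k
length-interval-∷ʳ a zero    N = refl
length-interval-∷ʳ a (suc k) N = cong suc (length-interval-∷ʳ (suc a) k N)

Linked-interval-∷ʳ : ∀ a k N → All (_< N) (interval a k) → Linked _<_ (interval a k ++ [ N ])
Linked-interval-∷ʳ a zero          N _          = [-]
Linked-interval-∷ʳ a (suc zero)    N (a<N ∷ _)  = a<N ∷ [-]
Linked-interval-∷ʳ a (suc (suc k)) N (_ ∷ <N)   = n<1+n a ∷ Linked-interval-∷ʳ (suc a) (suc k) N <N

All-≤-sum : ∀ xs → All (_≤ sum xs) xs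
All-≤-sum []       = []
All-≤-sum (x ∷ xs) = m≤m+n x (sum xs) ∷ All.map (λ y≤ → ≤-trans y≤ (m≤n+m (sum xs) x)) (All-≤-sum xs)

∈⇒sum≤sum-map-sum : ∀ {xs xss} → xs ∈ xss → sum xs ≤ sum (map sum xss)
∈⇒sum≤sum-map-sum {xs} (here refl) = m≤m+n (sum xs) _
∈⇒sum≤sum-map-sum {xss = ys ∷ _} (there xs∈) = ≤-trans (∈⇒sum≤sum-map-sum xs∈) (m≤n+m _ (sum ys))

primeSet-sum> : ∀ n → n ≥ 1 → (M : ℕ) →
  Σ (List ℕ) (λ A → IsPosSetOfSize n A × IsPrimeSet A × M < sum A)
primeSet-sum> (suc k) _ M =
  xs ++ [ N ] , ((linked , positive) , length-interval-∷ʳ 2 k N) , prime , M<sum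
  where
  xs = interval 2 k
  T  = sum xs
  c  = T + T + M
  S  = T ! * c + 1
  N  = S ∸ T

  c<S : c < S
  c<S = ≤-<-trans (m≤n*m c (T !) {{T !≢0}}) (m<m+n (T ! * c) z<s)

  T+N≡S : T + N ≡ S
  T+N≡S = m+[n∸m]≡n (≤-trans (m≤m+n T T) (≤-trans (m≤m+n (T + T) M) (<⇒≤ c<S)))

  T<N : T < N
  T<N = +-cancelˡ-< T T N (subst (T + T <_) (sym T+N≡S) (≤-<-trans (m≤m+n (T + T) M) c<S))

  xs≥2 : All (2 ≤_) xs
  xs≥2 = All-≤-interval 2 k

  linked : Linked _<_ (xs ++ [ N ])
  linked = Linked-interval-∷ʳ 2 k N (All.map (λ x≤T → ≤-<-trans x≤T T<N) (All-≤-sum xs))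

  positive : All (0 <_) (xs ++ [ N ])
  positive = ++⁺ (All.map (<-trans z<s) xs≥2) (≤-<-trans z≤n T<N ∷ [])

  prime : IsPrimeSet (xs ++ [ N ])
  prime = isPrimeSet-∷ʳ xs N xs≥2 T<N
    (λ s 2≤s s≤T → subst (s ∤_) (sym T+N≡S) (m≤n⇒m∤n!*c+1 c 2≤s s≤T))

  M<sum : M < sum (xs ++ [ N ])
  M<sum = subst (M <_) (sym (trans (sum-∷ʳ xs N) T+N≡S)) (≤-<-trans (m≤n+m M (T + T)) c<S)

mainTheorem6 : (n : ℕ) → n ≥ 1 → (L : List (List ℕ)) →
    Σ (List ℕ) (λ A → IsPosSetOfSize n A × IsPrimeSet A × A ∉ L)
mainTheorem6 n n≥1 L with primeSet-sum> n n≥1 (sum (map sum L))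
... | A , isSet , prime , large = A , isSet , prime , λ A∈L → <⇒≱ large (∈⇒sum≤sum-map-sum A∈L)
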